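{- Let $T,S\subseteq\mathbb{Z}_{>0}$ be finite with $T\preceq S$, and let $S'\subsetneq S$. Let $a=\min(S\setminus S')$ and $b=\min((T\triangleleft S)\setminus(T\triangleleft S'))$. Then $T\triangleleft(S\setminus\{a\})=(T\triangleleft S)\setminus\{b\}$.
   Context: For finite $T,S\subseteq\mathbb{Z}_{>0}$, $T\triangleleft S$ is computed by going through $s\in S$ from largest to smallest; each $s$ picks the largest not-yet-picked $t\in T$ with $t<s$, if one exists; $T\triangleleft S$ is the set of picked elements. $S(i)$ denotes the $i$-th smallest element of $S$. $T\preceq S$ means $|T|\ge|S|$ and $T(i)<S(i)$ for all $i\in[|S|]$. -}

module Defs where

open import Data.Nat using (ℕ; _<_; _≤_; _≟_; _<?_; _⊔_)
open import Data.List using (List; []; _∷_; filter; foldr; length; lookup)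
open import Data.List.Relation.Unary.All using (All)
open import Data.List.Relation.Unary.Linked using (Linked)
open import Data.List.Membership.Propositional using (_∈_; _∉_)
open import Data.List.Membership.DecPropositional _≟_ using (_∈?_)
open import Data.Fin using (Fin; inject≤)
open import Data.Maybe using (Maybe; just; nothing)
open import Data.Product using (Σ; _×_)
open import Relation.Nullary using (yes; no; ¬?)

-- A finite subset of ℤ>0 is represented canonically as a strictly
-- increasing list of positive naturals.  So S(i) = lookup S i (0-indexed).
IsFinPosSet : List ℕ → Set
IsFinPosSet S = Linked _<_ S × All (0 <_) S

largestBelow : ℕ → List ℕ → Maybe ℕ
largestBelow s [] = nothing
largestBelow s (t ∷ ts) with t <? s | largestBelow s ts
... | yes _ | nothing = just t
... | yes _ | just u  = just (t ⊔ u)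
... | no  _ | r       = r

_∖｛_｝ : List ℕ → ℕ → List ℕ
A ∖｛ x ｝ = filter (λ y → ¬? (y ≟ x)) A

pickStep : ℕ → List ℕ → List ℕ
pickStep s avail with largestBelow s avail
... | nothing = avail
... | just t  = avail ∖｛ t ｝

-- the not-yet-picked elements of T after processing all s ∈ S
-- (foldr processes the increasing list S from its largest element down)
unpicked : List ℕ → List ℕ → List ℕ
unpicked T S = foldr pickStep T S

_◁_ : List ℕ → List ℕ → List ℕ
T ◁ S = filter (λ t → ¬? (t ∈? unpicked T S)) T

_⪯_ : List ℕ → List ℕ → Set
T ⪯ S = Σ (length S ≤ length T) λ le →
          (i : Fin (length S)) → lookup T (inject≤ i le) < lookup S i

_⊊_ : List ℕ → List ℕ → Set
S' ⊊ S = (∀ x → x ∈ S' → x ∈ S) × Σ ℕ (λ x → x ∈ S × x ∉ S')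

IsMinDiff : ℕ → List ℕ → List ℕ → Set
IsMinDiff m A B = m ∈ A × m ∉ B × (∀ y → y ∈ A → y ∉ B → m ≤ y)

-- Since T ⪯ S, every s ∈ S finds an element of T to pick.  Deleting a from S
-- therefore frees exactly one element x < a: following the picks below a,
-- each step either picks the same element as before or takes the currently
-- freed element, which frees the one it used to pick, and the last freed
-- element is x.  So T ◁ (S ∖ {a}) = (T ◁ S) ∖ {x}.  Which elements below a
-- surviving x get picked depends only on the elements of S up to x; these
-- are the same in S ∖ {a} and in S′ (everything in S ∖ S′ is at least a), so
-- the unpicked sets of S ∖ {a} and of S′ agree below x, and x is also
-- unpicked by S′ ⊆ S ∖ {a}.  This makes x the least element of
-- (T ◁ S) ∖ (T ◁ S′).
module Submission where

open import Defs
open import Data.Nat using (ℕ; _<_; _≤_; _>_; _≟_; _<?_; _≤?_; s≤s)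
open import Data.Nat.Properties
  using ( <-trans; <-irrefl; <⇒≤; <⇒≢; <⇒≱; ≮⇒≥; ≰⇒>; ≤-refl; ≤-trans; ≤-antisym
        ; <-≤-trans; ≤-<-trans; ⊔-sel; ⊔-lub; m≤m⊔n; m≤n⊔m )
open import Data.List using (List; []; _∷_; filter)
open import Data.List.Properties using (filter-accept; filter-reject; filter-all)
open import Data.List.Membership.Propositional using (_∈_; _∉_)
open import Data.List.Membership.Propositional.Properties using (∈-filter⁺; ∈-filter⁻)
open import Data.List.Membership.DecPropositional _≟_ using (_∈?_)
open import Data.List.Relation.Unary.Any using (here; there)
open import Data.List.Relation.Unary.All as All using (All)
open import Data.List.Relation.Unary.AllPairs using (AllPairs; _∷_)
import Data.List.Relation.Unary.AllPairs.Properties as AllPairs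
open import Data.List.Relation.Unary.Linked using (Linked)
open import Data.List.Relation.Unary.Linked.Properties using (Linked⇒AllPairs)
open import Data.List.Relation.Binary.Subset.Propositional using (_⊆_)
open import Data.List.Relation.Binary.Sublist.Propositional
  using ([]; _∷_; _∷ʳ_; minimum) renaming (_⊆_ to _⊑_; ⊆-antisym to ⊑-antisym)
open import Data.List.Relation.Binary.Prefix.Heterogeneous using (Prefix; []; _∷_)
open import Data.Fin using () renaming (zero to fzero; suc to fsuc)
open import Data.Maybe using (Maybe; just; nothing)
open import Data.Product using (Σ; _×_; _,_; proj₁; proj₂; ∃; ∃-syntax)
open import Data.Sum using (_⊎_; inj₁; inj₂; [_,_]′)
open import Data.Unit using (⊤; tt)
open import Data.Empty using (⊥-elim)
open import Function using (_∘_; case_of_; _⇔_; mk⇔; Equivalence)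
open import Function.Properties.Equivalence using ()
  renaming (refl to ⇔-refl; sym to ⇔-sym; trans to ⇔-trans)
open import Relation.Nullary using (yes; no; ¬?; contradiction; _×-dec_)
open import Relation.Binary.PropositionalEquality
  using (_≡_; _≢_; refl; sym; trans; cong; subst; subst₂; module ≡-Reasoning)

Sorted : List ℕ → Set
Sorted = AllPairs _<_

Linked⇒Sorted : ∀ {xs} → Linked _<_ xs → Sorted xs
Linked⇒Sorted = Linked⇒AllPairs <-trans

head-≤ : ∀ {x xs z} → All (x <_) xs → z ∈ x ∷ xs → x ≤ z
head-≤ _    (here refl)  = ≤-refl
head-≤ x<xs (there z∈xs) = <⇒≤ (All.lookup x<xs z∈xs)

sorted-⊆⇒⊑ : ∀ {xs ys} → Sorted xs → Sorted ys → xs ⊆ ys → xs ⊑ ys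
sorted-⊆⇒⊑ {[]}              _            _            _     = minimum _
sorted-⊆⇒⊑ {x ∷ xs} {[]}     _            _            xs⊆ys with xs⊆ys (here refl)
... | ()
sorted-⊆⇒⊑ {x ∷ xs} {y ∷ ys} (x<xs ∷ xs↗) (y<ys ∷ ys↗) xs⊆ys with xs⊆ys (here refl)
... | here refl  = refl ∷ sorted-⊆⇒⊑ xs↗ ys↗ λ z∈xs → case xs⊆ys (there z∈xs) of λ
  { (here refl)  → ⊥-elim (<-irrefl refl (All.lookup x<xs z∈xs))
  ; (there z∈ys) → z∈ys }
... | there x∈ys = y ∷ʳ sorted-⊆⇒⊑ (x<xs ∷ xs↗) ys↗ λ z∈x∷xs → case xs⊆ys z∈x∷xs of λ
  { (here refl)  → ⊥-elim (<⇒≱ (All.lookup y<ys x∈ys) (head-≤ x<xs z∈x∷xs))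
  ; (there z∈ys) → z∈ys }

sorted-⊆-antisym : ∀ {xs ys} → Sorted xs → Sorted ys → xs ⊆ ys → ys ⊆ xs → xs ≡ ys
sorted-⊆-antisym xs↗ ys↗ xs⊆ys ys⊆xs =
  ⊑-antisym (sorted-⊆⇒⊑ xs↗ ys↗ xs⊆ys) (sorted-⊆⇒⊑ ys↗ xs↗ ys⊆xs)

∈-∖⁺ : ∀ {A t z} → z ∈ A → z ≢ t → z ∈ A ∖｛ t ｝
∈-∖⁺ {t = t} = ∈-filter⁺ (λ y → ¬? (y ≟ t))

∈-∖⁻ : ∀ {A t z} → z ∈ A ∖｛ t ｝ → z ∈ A × z ≢ t
∈-∖⁻ {A} {t} = ∈-filter⁻ (λ y → ¬? (y ≟ t)) {xs = A}

∖-∷-≢ : ∀ {t u} A → u ≢ t → (u ∷ A) ∖｛ t ｝ ≡ u ∷ A ∖｛ t ｝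
∖-∷-≢ {t} A = filter-accept (λ y → ¬? (y ≟ t)) {xs = A}

∖-head : ∀ {t A} → All (t <_) A → (t ∷ A) ∖｛ t ｝ ≡ A
∖-head {t} {A} t<A =
  trans (filter-reject (λ y → ¬? (y ≟ t)) {xs = A} (λ t≢t → t≢t refl))
        (filter-all (λ y → ¬? (y ≟ t)) (All.map (λ t<y → <⇒≢ t<y ∘ sym) t<A))

record IsLargestBelow (s : ℕ) (A : List ℕ) (t : ℕ) : Set where
  field
    member  : t ∈ A
    below   : t < s
    largest : ∀ {u} → u ∈ A → u < s → u ≤ t

open IsLargestBelow

LargestBelow : ℕ → List ℕ → Maybe ℕ → Set
LargestBelow s A (just t) = IsLargestBelow s A t
LargestBelow s A nothing  = ∀ {u} → u ∈ A → s ≤ u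

largestBelow-correct : ∀ s A → LargestBelow s A (largestBelow s A)
largestBelow-correct s [] ()
largestBelow-correct s (t ∷ A) with t <? s | largestBelow s A | largestBelow-correct s A
... | yes t<s | nothing | none = record
  { member  = here refl
  ; below   = t<s
  ; largest = λ { (here refl) _ → ≤-refl ; (there u∈A) u<s → ⊥-elim (<⇒≱ u<s (none u∈A)) } }
... | yes t<s | just u  | lb = record
  { member  = [ (λ t⊔u≡t → subst (_∈ t ∷ A) (sym t⊔u≡t) (here refl))
              , (λ t⊔u≡u → subst (_∈ t ∷ A) (sym t⊔u≡u) (there (member lb))) ]′ (⊔-sel t u)
  ; below   = ⊔-lub t<s (below lb)
  ; largest = λ { (here refl) _ → m≤m⊔n t u
                ; (there v∈A) v<s → ≤-trans (largest lb v∈A v<s) (m≤n⊔m t u) } }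
... | no t≮s  | just u  | lb = record
  { member  = there (member lb)
  ; below   = below lb
  ; largest = λ { (here refl) t<s → contradiction t<s t≮s ; (there v∈A) → largest lb v∈A } }
... | no t≮s  | nothing | none = λ { (here refl) → ≮⇒≥ t≮s ; (there u∈A) → none u∈A }

IsLargestBelow-unique : ∀ {s A t t′} → IsLargestBelow s A t → IsLargestBelow s A t′ → t ≡ t′
IsLargestBelow-unique lb lb′ =
  ≤-antisym (largest lb′ (member lb) (below lb)) (largest lb (member lb′) (below lb′))

IsLargestBelow-∷ : ∀ {s A t u} → u < t → IsLargestBelow s A t → IsLargestBelow s (u ∷ A) t
IsLargestBelow-∷ u<t lb = record
  { member  = there (member lb)
  ; below   = below lb
  ; largest = λ { (here refl) _ → <⇒≤ u<t ; (there v∈A) → largest lb v∈A } }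

largestBelow-exists : ∀ {s A u} → u ∈ A → u < s → ∃ (IsLargestBelow s A)
largestBelow-exists {s} {A} u∈A u<s with largestBelow s A | largestBelow-correct s A
... | just t  | lb   = t , lb
... | nothing | none = ⊥-elim (<⇒≱ u<s (none u∈A))

data PickStep (s : ℕ) (A : List ℕ) : List ℕ → Set where
  picks : ∀ {t} → IsLargestBelow s A t → PickStep s A (A ∖｛ t ｝)
  skips : (∀ {u} → u ∈ A → s ≤ u) → PickStep s A A

pickStep-view : ∀ s A → PickStep s A (pickStep s A)
pickStep-view s A with largestBelow s A | largestBelow-correct s A
... | just t  | lb   = picks lb
... | nothing | none = skips none

pickStep-picks : ∀ {s A t} → IsLargestBelow s A t → pickStep s A ≡ A ∖｛ t ｝
pickStep-picks {s} {A} lb with pickStep s A | pickStep-view s A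
... | _ | picks lb′  = cong (A ∖｛_｝) (IsLargestBelow-unique lb′ lb)
... | _ | skips none = ⊥-elim (<⇒≱ (below lb) (none (member lb)))

pickStep-⊆ : ∀ {s A} → pickStep s A ⊆ A
pickStep-⊆ {s} {A} with pickStep s A | pickStep-view s A
... | _ | picks _ = proj₁ ∘ ∈-∖⁻
... | _ | skips _ = λ z∈A → z∈A

unpicked-⊆ : ∀ {A} L → unpicked A L ⊆ A
unpicked-⊆ []      = λ z∈A → z∈A
unpicked-⊆ (s ∷ L) = unpicked-⊆ L ∘ pickStep-⊆

pickStep-keeps : ∀ {s A B z} → (∀ {u} → u ∈ A → u < s → u ∈ B) →
                 z ∈ pickStep s A → z ∈ B → z ∈ pickStep s B
pickStep-keeps {s} {A} {B} {z} A<s⊆B z∈A′ z∈B with pickStep s B | pickStep-view s B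
... | _ | skips _        = z∈B
... | _ | picks {t′} lb′ = ∈-∖⁺ z∈B z≢t′
  where
  z≢t′ : z ≢ t′
  z≢t′ refl with pickStep s A | pickStep-view s A
  ... | _ | skips none = <⇒≱ (below lb′) (none z∈A′)
  ... | _ | picks lb   = let z∈A , z≢t = ∈-∖⁻ {A} z∈A′ in
    z≢t (≤-antisym (largest lb z∈A (below lb′))
                   (largest lb′ (A<s⊆B (member lb) (below lb)) (below lb)))

pickStep-mono : ∀ {s A B} → A ⊆ B → pickStep s A ⊆ pickStep s B
pickStep-mono A⊆B z∈A′ = pickStep-keeps (λ u∈A _ → A⊆B u∈A) z∈A′ (A⊆B (pickStep-⊆ z∈A′))

unpicked-mono : ∀ {A A′ L L′} → L′ ⊑ L → A ⊆ A′ → unpicked A L ⊆ unpicked A′ L′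
unpicked-mono []            A⊆A′ = A⊆A′
unpicked-mono (s ∷ʳ L′⊑L)   A⊆A′ = unpicked-mono L′⊑L A⊆A′ ∘ pickStep-⊆
unpicked-mono (refl ∷ L′⊑L) A⊆A′ = pickStep-mono (unpicked-mono L′⊑L A⊆A′)

AllMatched : List ℕ → List ℕ → Set
AllMatched A []      = ⊤
AllMatched A (s ∷ L) = AllMatched A L × ∃ (IsLargestBelow s (unpicked A L))

unpicked-∷ : ∀ {u A} L → All (u <_) A → AllMatched A L →
             unpicked (u ∷ A) L ≡ u ∷ unpicked A L × AllMatched (u ∷ A) L
unpicked-∷ []              _   _                  = refl , tt
unpicked-∷ {u} {A} (s ∷ L) u<A (matched , t , lb) with unpicked-∷ L u<A matched
... | eq , matched′ = step , matched′ , t , subst (λ B → IsLargestBelow s B t) (sym eq) lb′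
  where
  u<t : u < t
  u<t = All.lookup u<A (unpicked-⊆ L (member lb))
  lb′ : IsLargestBelow s (u ∷ unpicked A L) t
  lb′ = IsLargestBelow-∷ u<t lb
  open ≡-Reasoning
  step : pickStep s (unpicked (u ∷ A) L) ≡ u ∷ pickStep s (unpicked A L)
  step = begin
    pickStep s (unpicked (u ∷ A) L)  ≡⟨ cong (pickStep s) eq ⟩
    pickStep s (u ∷ unpicked A L)    ≡⟨ pickStep-picks lb′ ⟩
    (u ∷ unpicked A L) ∖｛ t ｝       ≡⟨ ∖-∷-≢ (unpicked A L) (λ u≡t → <-irrefl u≡t u<t) ⟩
    u ∷ unpicked A L ∖｛ t ｝         ≡⟨ cong (u ∷_) (sym (pickStep-picks lb)) ⟩
    u ∷ pickStep s (unpicked A L)    ∎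

⪯⇒Prefix : ∀ {T} S → T ⪯ S → Prefix _>_ S T
⪯⇒Prefix []      _ = []
⪯⇒Prefix {[]}    (s ∷ S) (() , _)
⪯⇒Prefix {t ∷ T} (s ∷ S) (s≤s |S|≤|T| , T<S) = T<S fzero ∷ ⪯⇒Prefix S (|S|≤|T| , T<S ∘ fsuc)

Prefix⇒AllMatched : ∀ {T S} → Sorted T → Prefix _>_ S T → AllMatched T S
Prefix⇒AllMatched _ [] = tt
Prefix⇒AllMatched {u ∷ T} {s ∷ S} (u<T ∷ T↗) (u<s ∷ T<S)
  with unpicked-∷ S u<T (Prefix⇒AllMatched T↗ T<S)
... | eq , matched = matched , largestBelow-exists (subst (u ∈_) (sym eq) (here refl)) u<s

record _≈_⊎｛_｝ (A′ A : List ℕ) (e : ℕ) : Set where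
  field
    fresh    : e ∉ A
    inserted : e ∈ A′
    kept     : A ⊆ A′
    only     : ∀ {z} → z ∈ A′ → z ∈ A ⊎ z ≡ e

open _≈_⊎｛_｝

≈-∖⊎ : ∀ {A t} → t ∈ A → A ≈ A ∖｛ t ｝ ⊎｛ t ｝
≈-∖⊎ {A} {t} t∈A = record
  { fresh    = λ t∈A∖t → proj₂ (∈-∖⁻ {A} t∈A∖t) refl
  ; inserted = t∈A
  ; kept     = proj₁ ∘ ∈-∖⁻ {A}
  ; only     = split }
  where
  split : ∀ {z} → z ∈ A → z ∈ A ∖｛ t ｝ ⊎ z ≡ t
  split {z} z∈A with z ≟ t
  ... | yes z≡t = inj₂ z≡t
  ... | no  z≢t = inj₁ (∈-∖⁺ z∈A z≢t)

∖-≈⊎ : ∀ {A′ A e t} → A′ ≈ A ⊎｛ e ｝ → t ≢ e → A′ ∖｛ t ｝ ≈ A ∖｛ t ｝ ⊎｛ e ｝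
∖-≈⊎ ext t≢e = record
  { fresh    = fresh ext ∘ proj₁ ∘ ∈-∖⁻
  ; inserted = ∈-∖⁺ (inserted ext) (t≢e ∘ sym)
  ; kept     = λ z∈A∖t → let z∈A , z≢t = ∈-∖⁻ z∈A∖t in ∈-∖⁺ (kept ext z∈A) z≢t
  ; only     = λ z∈A′∖t → let z∈A′ , z≢t = ∈-∖⁻ z∈A′∖t in
                 [ (λ z∈A → inj₁ (∈-∖⁺ z∈A z≢t)) , inj₂ ]′ (only ext z∈A′) }

∖-≈⊎-swap : ∀ {A′ A e t} → A′ ≈ A ⊎｛ e ｝ → t ∈ A → A′ ∖｛ e ｝ ≈ A ∖｛ t ｝ ⊎｛ t ｝
∖-≈⊎-swap {A′} {A} {e} {t} ext t∈A = record
  { fresh    = fresh (≈-∖⊎ t∈A)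
  ; inserted = ∈-∖⁺ (kept ext t∈A) (≢-inserted t∈A)
  ; kept     = λ z∈A∖t → let z∈A = proj₁ (∈-∖⁻ z∈A∖t) in ∈-∖⁺ (kept ext z∈A) (≢-inserted z∈A)
  ; only     = λ z∈A′∖e → let z∈A′ , z≢e = ∈-∖⁻ z∈A′∖e in
                 [ only (≈-∖⊎ t∈A) , ⊥-elim ∘ z≢e ]′ (only ext z∈A′) }
  where
  ≢-inserted : ∀ {z} → z ∈ A → z ≢ e
  ≢-inserted z∈A refl = fresh ext z∈A

IsLargestBelow-inserted : ∀ {s A′ A e t} → A′ ≈ A ⊎｛ e ｝ → IsLargestBelow s A t →
                          t < e → e < s → IsLargestBelow s A′ e
IsLargestBelow-inserted ext lb t<e e<s = record
  { member  = inserted ext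
  ; below   = e<s
  ; largest = λ u∈A′ u<s →
      [ (λ u∈A → ≤-trans (largest lb u∈A u<s) (<⇒≤ t<e)) , (λ { refl → ≤-refl }) ]′ (only ext u∈A′) }

IsLargestBelow-kept : ∀ {s A′ A e t} → A′ ≈ A ⊎｛ e ｝ → IsLargestBelow s A t →
                      (e < s → e ≤ t) → IsLargestBelow s A′ t
IsLargestBelow-kept ext lb e<s⇒e≤t = record
  { member  = kept ext (member lb)
  ; below   = below lb
  ; largest = λ u∈A′ u<s →
      [ (λ u∈A → largest lb u∈A u<s) , (λ { refl → e<s⇒e≤t u<s }) ]′ (only ext u∈A′) }

-- If t < e < s, then s takes e instead of t, and t becomes the extra element.
pickStep-≈⊎ : ∀ {s A′ A e t} → A′ ≈ A ⊎｛ e ｝ → IsLargestBelow s A t →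
              ∃[ e′ ] e′ ≤ e × pickStep s A′ ≈ pickStep s A ⊎｛ e′ ｝
pickStep-≈⊎ {s} {A′} {A} {e} {t} ext lb rewrite pickStep-picks lb with t <? e ×-dec e <? s
... | yes (t<e , e<s) rewrite pickStep-picks (IsLargestBelow-inserted ext lb t<e e<s) =
  t , <⇒≤ t<e , ∖-≈⊎-swap ext (member lb)
... | no ¬t<e<s = both-pick-t (λ e<s → ≮⇒≥ (λ t<e → ¬t<e<s (t<e , e<s)))
  where
  both-pick-t : (e < s → e ≤ t) → ∃[ e′ ] e′ ≤ e × pickStep s A′ ≈ A ∖｛ t ｝ ⊎｛ e′ ｝
  both-pick-t e<s⇒e≤t rewrite pickStep-picks (IsLargestBelow-kept ext lb e<s⇒e≤t) =
    e , ≤-refl , ∖-≈⊎ ext (λ { refl → fresh ext (member lb) })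

unpicked-∖ : ∀ {T a} S → Sorted S → AllMatched T S → a ∈ S →
             ∃[ x ] x < a × unpicked T (S ∖｛ a ｝) ≈ unpicked T S ⊎｛ x ｝
unpicked-∖ {T} (s ∷ S) (s<S ∷ _) (_ , t , lb) (here refl) =
  t , below lb ,
  subst₂ (λ L B → unpicked T L ≈ B ⊎｛ t ｝) (sym (∖-head s<S)) (sym (pickStep-picks lb))
         (≈-∖⊎ (member lb))
unpicked-∖ (s ∷ S) (s<S ∷ S↗) (matched , t , lb) (there a∈S)
  rewrite ∖-∷-≢ S (<⇒≢ (All.lookup s<S a∈S)) with unpicked-∖ S S↗ matched a∈S
... | x′ , x′<a , ext with pickStep-≈⊎ ext lb
... | x , x≤x′ , ext′ = x , ≤-<-trans x≤x′ x′<a , ext′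

AgreeBelow : ℕ → List ℕ → List ℕ → Set
AgreeBelow x A B = ∀ {y} → y < x → y ∈ A ⇔ y ∈ B

AgreeBelow-refl : ∀ {x A} → AgreeBelow x A A
AgreeBelow-refl _ = ⇔-refl

AgreeBelow-sym : ∀ {x A B} → AgreeBelow x A B → AgreeBelow x B A
AgreeBelow-sym A~B = ⇔-sym ∘ A~B

AgreeBelow-trans : ∀ {x A B C} → AgreeBelow x A B → AgreeBelow x B C → AgreeBelow x A C
AgreeBelow-trans A~B B~C y<x = ⇔-trans (A~B y<x) (B~C y<x)

pickStep-agreeBelow : ∀ {x s A B} → s ≤ x → AgreeBelow x A B →
                      AgreeBelow x (pickStep s A) (pickStep s B)
pickStep-agreeBelow {x} {s} s≤x A~B {y} y<x = mk⇔ (transfer A~B) (transfer (AgreeBelow-sym A~B))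
  where
  transfer : ∀ {A B} → AgreeBelow x A B → y ∈ pickStep s A → y ∈ pickStep s B
  transfer A~B y∈A′ =
    pickStep-keeps (λ u∈A u<s → Equivalence.to (A~B (<-≤-trans u<s s≤x)) u∈A) y∈A′
                   (Equivalence.to (A~B y<x) (pickStep-⊆ y∈A′))

pickStep-agreeBelow-survivor : ∀ {x s A} → x ∈ pickStep s A → x < s → AgreeBelow x (pickStep s A) A
pickStep-agreeBelow-survivor {x} {s} {A} x∈A′ x<s with pickStep s A | pickStep-view s A
... | _ | skips _        = AgreeBelow-refl
... | _ | picks {t} lb   = λ y<x →
  mk⇔ (proj₁ ∘ ∈-∖⁻ {A}) (λ y∈A → ∈-∖⁺ y∈A (<⇒≢ (<-≤-trans y<x x≤t)))
  where
  x≤t : x ≤ t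
  x≤t = largest lb (proj₁ (∈-∖⁻ {A} x∈A′)) x<s

unpicked-agreesBelow-filter : ∀ {x A} L → x ∈ unpicked A L →
                              AgreeBelow x (unpicked A L) (unpicked A (filter (_≤? x) L))
unpicked-agreesBelow-filter []      _   = AgreeBelow-refl
unpicked-agreesBelow-filter {x} (s ∷ L) x∈U with s ≤? x
... | yes s≤x rewrite filter-accept (_≤? x) {xs = L} s≤x =
  pickStep-agreeBelow s≤x (unpicked-agreesBelow-filter L (pickStep-⊆ x∈U))
... | no  s≰x rewrite filter-reject (_≤? x) {xs = L} s≰x =
  AgreeBelow-trans (pickStep-agreeBelow-survivor x∈U (≰⇒> s≰x))
                   (unpicked-agreesBelow-filter L (pickStep-⊆ x∈U))

unpicked-agreesBelow : ∀ {x A L L′} → Sorted L → Sorted L′ → (∀ {z} → z ≤ x → z ∈ L ⇔ z ∈ L′) →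
                       x ∈ unpicked A L → x ∈ unpicked A L′ →
                       AgreeBelow x (unpicked A L) (unpicked A L′)
unpicked-agreesBelow {x} {A} {L} {L′} L↗ L′↗ L~L′ x∈U x∈U′ =
  AgreeBelow-trans (unpicked-agreesBelow-filter L x∈U)
    (subst (λ K → AgreeBelow x (unpicked A K) (unpicked A L′)) (sym L≤x≡L′≤x)
      (AgreeBelow-sym (unpicked-agreesBelow-filter L′ x∈U′)))
  where
  transfer : ∀ {K K′} → (∀ {z} → z ≤ x → z ∈ K → z ∈ K′) → filter (_≤? x) K ⊆ filter (_≤? x) K′
  transfer {K} K⊆K′ z∈K≤x = let z∈K , z≤x = ∈-filter⁻ (_≤? x) {xs = K} z∈K≤x in
    ∈-filter⁺ (_≤? x) (K⊆K′ z≤x z∈K) z≤x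
  L≤x≡L′≤x : filter (_≤? x) L ≡ filter (_≤? x) L′
  L≤x≡L′≤x = sorted-⊆-antisym (AllPairs.filter⁺ (_≤? x) L↗) (AllPairs.filter⁺ (_≤? x) L′↗)
    (transfer (Equivalence.to ∘ L~L′)) (transfer (Equivalence.from ∘ L~L′))

∈-◁⁺ : ∀ {T} S {t} → t ∈ T → t ∉ unpicked T S → t ∈ T ◁ S
∈-◁⁺ {T} S = ∈-filter⁺ (λ t → ¬? (t ∈? unpicked T S))

∈-◁⁻ : ∀ {T} S {t} → t ∈ T ◁ S → t ∈ T × t ∉ unpicked T S
∈-◁⁻ {T} S = ∈-filter⁻ (λ t → ¬? (t ∈? unpicked T S)) {xs = T}

∉-◁ : ∀ {T} S {t} → t ∈ T → t ∉ T ◁ S → t ∈ unpicked T S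
∉-◁ {T} S {t} t∈T t∉T◁S with t ∈? unpicked T S
... | yes t∈U = t∈U
... | no  t∉U = ⊥-elim (t∉T◁S (∈-◁⁺ S t∈T t∉U))

◁-≈⊎ : ∀ {T} S₁ S {x} → Sorted T → unpicked T S₁ ≈ unpicked T S ⊎｛ x ｝ → T ◁ S₁ ≡ (T ◁ S) ∖｛ x ｝
◁-≈⊎ {T} S₁ S {x} T↗ ext =
  sorted-⊆-antisym (AllPairs.filter⁺ _ T↗) (AllPairs.filter⁺ _ (AllPairs.filter⁺ _ T↗)) to from
  where
  to : T ◁ S₁ ⊆ (T ◁ S) ∖｛ x ｝
  to z∈T◁S₁ = let z∈T , z∉U₁ = ∈-◁⁻ S₁ z∈T◁S₁ in
    ∈-∖⁺ (∈-◁⁺ S z∈T (z∉U₁ ∘ kept ext)) (λ { refl → z∉U₁ (inserted ext) })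
  from : (T ◁ S) ∖｛ x ｝ ⊆ T ◁ S₁
  from z∈T◁S∖x = let z∈T◁S , z≢x = ∈-∖⁻ {T ◁ S} z∈T◁S∖x ; z∈T , z∉U = ∈-◁⁻ S z∈T◁S in
    ∈-◁⁺ S₁ z∈T λ z∈U₁ → [ z∉U , z≢x ]′ (only ext z∈U₁)

◁-minDiff : ∀ {T} S Sₐ S′ {x} → unpicked T Sₐ ≈ unpicked T S ⊎｛ x ｝ →
            unpicked T Sₐ ⊆ unpicked T S′ → AgreeBelow x (unpicked T Sₐ) (unpicked T S′) →
            IsMinDiff x (T ◁ S) (T ◁ S′)
◁-minDiff {T} S Sₐ S′ {x} ext Uₐ⊆U′ Uₐ~U′ = x∈T◁S , x∉T◁S′ , x-min
  where
  x∈T◁S : x ∈ T ◁ S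
  x∈T◁S = ∈-◁⁺ S (unpicked-⊆ Sₐ (inserted ext)) (fresh ext)
  x∉T◁S′ : x ∉ T ◁ S′
  x∉T◁S′ x∈T◁S′ = proj₂ (∈-◁⁻ S′ x∈T◁S′) (Uₐ⊆U′ (inserted ext))
  x-min : ∀ y → y ∈ T ◁ S → y ∉ T ◁ S′ → x ≤ y
  x-min y y∈T◁S y∉T◁S′ with y <? x
  ... | no  y≮x = ≮⇒≥ y≮x
  ... | yes y<x = let y∈T , y∉U = ∈-◁⁻ S y∈T◁S
                      y∈Uₐ     = Equivalence.from (Uₐ~U′ y<x) (∉-◁ S′ y∈T y∉T◁S′) in
    ⊥-elim ([ y∉U , (λ y≡x → <-irrefl y≡x y<x) ]′ (only ext y∈Uₐ))

lemma4p15 : (T S S' : List ℕ) → IsFinPosSet T → IsFinPosSet S → IsFinPosSet S' →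
    T ⪯ S → S' ⊊ S → (a : ℕ) → IsMinDiff a S S' →
    Σ ℕ (λ b → IsMinDiff b (T ◁ S) (T ◁ S') × (T ◁ (S ∖｛ a ｝) ≡ (T ◁ S) ∖｛ b ｝))
lemma4p15 T S S' (T↗ , _) (S↗ , _) (S'↗ , _) T⪯S (S'⊆S , _) a (a∈S , a∉S' , a-min)
  with unpicked-∖ S (Linked⇒Sorted S↗) (Prefix⇒AllMatched (Linked⇒Sorted T↗) (⪯⇒Prefix S T⪯S)) a∈S
... | x , x<a , ext =
  x , ◁-minDiff S (S ∖｛ a ｝) S' ext Uₐ⊆U′ Uₐ~U′ , ◁-≈⊎ (S ∖｛ a ｝) S (Linked⇒Sorted T↗) ext
  where
  Sₐ↗ : Sorted (S ∖｛ a ｝)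
  Sₐ↗ = AllPairs.filter⁺ _ (Linked⇒Sorted S↗)
  S'⊆Sₐ : S' ⊆ S ∖｛ a ｝
  S'⊆Sₐ z∈S' = ∈-∖⁺ (S'⊆S _ z∈S') λ { refl → a∉S' z∈S' }
  Sₐ⊆S'-upto-x : ∀ {z} → z ≤ x → z ∈ S ∖｛ a ｝ → z ∈ S'
  Sₐ⊆S'-upto-x {z} z≤x z∈Sₐ with z ∈? S'
  ... | yes z∈S' = z∈S'
  ... | no  z∉S' = ⊥-elim (<⇒≱ (≤-<-trans z≤x x<a) (a-min z (proj₁ (∈-∖⁻ {S} z∈Sₐ)) z∉S'))
  Uₐ⊆U′ : unpicked T (S ∖｛ a ｝) ⊆ unpicked T S'
  Uₐ⊆U′ = unpicked-mono (sorted-⊆⇒⊑ (Linked⇒Sorted S'↗) Sₐ↗ S'⊆Sₐ) (λ z∈T → z∈T)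
  Uₐ~U′ : AgreeBelow x (unpicked T (S ∖｛ a ｝)) (unpicked T S')
  Uₐ~U′ = unpicked-agreesBelow Sₐ↗ (Linked⇒Sorted S'↗) (λ z≤x → mk⇔ (Sₐ⊆S'-upto-x z≤x) S'⊆Sₐ)
                               (inserted ext) (Uₐ⊆U′ (inserted ext))
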